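{- Let $G$ be an infinite $2$-connected graph with a vertex $v$ of infinite degree such that $G$ contains no induced $K_\infty$. Let $\mathcal{V}$ be an infinite independent subset of the neighborhood of $v$, and let $T$ be a $\mathcal{V}$-connecting tree of $G-v$. If $T$ has a vertex of infinite degree, then $G$ contains as an induced subgraph a member of the family $\Theta_\infty$.
   Context: $K_\infty$ is the countably infinite complete graph. $\Theta_\infty$ is the family of graphs consisting of two specified vertices together with countably infinitely many pairwise internally disjoint paths between them. $\mathcal{V}$-connecting tree: let $H$ be a connected graph and $\mathcal{V}$ an infinite independent set of its vertices. Choose $v_1\in\mathcal V$, let $P^1$ be the single vertex $v_1$ and $t_1=v_1$. Let $P^2$ be a shortest path in $H$ from $v_1$ to a vertex of $\mathcal V\setminus\{v_1\}$, with $v_2$ its endpoint in $\mathcal V\setminus\{v_1\}$ and $t_2=v_1$. Having defined $v_i,t_i,P^i$ for $i\le k$, give every path $Q$ joining a vertex of $\mathcal V\setminus\{v_1,\dots,v_k\}$ to a vertex of $P^1\cup\dots\cup P^k$ the grade $(\gamma_1,\gamma_2,\gamma_3)$, where $\gamma_1$ is the length of $Q$, $\gamma_2$ is the minimum $i$ such that the endpoint $u$ of $Q$ lies on $P^i$, and $\gamma_3=\mathrm{dist}_{P^i}(u,t_i)$. Let $P^{k+1}$ be a path of lexicographically minimal grade, $t_{k+1}$ its endpoint on $P^1\cup\dots\cup P^k$ and $v_{k+1}$ its endpoint in $\mathcal V\setminus\{v_1,\dots,v_k\}$. The union $T$ of all $P^k$, rooted at $v_1$, is a $\mathcal V$-connecting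 tree of $H$. -}

module Defs where

open import Level using (0ℓ)
open import Data.Nat using (ℕ; zero; suc; _<_; _≤_; _∸_; ∣_-_∣)
open import Data.List using (List; []; _∷_; length; head; last)
open import Data.List.Membership.Propositional using (_∈_; _∉_)
open import Data.List.Relation.Unary.Linked using (Linked)
open import Data.List.Relation.Unary.Unique.Propositional using (Unique)
open import Data.Maybe using (just)
open import Data.Product using (Σ; ∃; ∃-syntax; _×_; _,_)
open import Data.Sum using (_⊎_)
open import Data.Empty using (⊥)
open import Data.Unit using (⊤)
open import Relation.Nullary using (¬_)
open import Relation.Binary.PropositionalEquality using (_≡_; _≢_)
open import Function.Definitions using (Injective)

record Graph : Set₁ where
  field
    V      : Set
    Adj    : V → V → Set
    sym    : ∀ {x y} → Adj x y → Adj y x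
    irrefl : ∀ {x} → ¬ Adj x x

module _ (G : Graph) where
  open Graph G

  InfiniteSet : (V → Set) → Set
  InfiniteSet S = Σ (ℕ → V) λ f → Injective _≡_ _≡_ f × (∀ n → S (f n))

  InfiniteGraph : Set
  InfiniteGraph = InfiniteSet (λ _ → ⊤)

  IsPathIn : (V → Set) → List V → V → V → Set
  IsPathIn S ps a b =
    Linked Adj ps × Unique ps × head ps ≡ just a × last ps ≡ just b
    × (∀ {x} → x ∈ ps → S x)

  IsPath : List V → V → V → Set
  IsPath ps a b = IsPathIn (λ _ → ⊤) ps a b

  pathLength : List V → ℕ
  pathLength ps = length ps ∸ 1

  ConnectedOn : (V → Set) → Set
  ConnectedOn S = ∀ a b → S a → S b → ∃[ ps ] IsPathIn S ps a b

  Connected : Set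
  Connected = ConnectedOn (λ _ → ⊤)

  TwoConnected : Set
  TwoConnected =
    (Σ V λ a → Σ V λ b → Σ V λ c → (a ≢ b × a ≢ c × b ≢ c))
    × Connected
    × (∀ x → ConnectedOn (λ (y : V) → y ≢ x))

  InfiniteDegree : V → Set
  InfiniteDegree x = InfiniteSet (Adj x)

  -- G contains an induced K∞ (a complete subgraph is automatically induced)
  HasInducedKInf : Set
  HasInducedKInf =
    Σ (ℕ → V) λ f → Injective _≡_ _≡_ f × (∀ i j → i ≢ j → Adj (f i) (f j))

  Independent : (V → Set) → Set
  Independent S = ∀ x y → S x → S y → ¬ Adj x y

  data Consec : List V → V → V → Set where
    here-→ : ∀ {x y zs} → Consec (x ∷ y ∷ zs) x y
    here-← : ∀ {x y zs} → Consec (x ∷ y ∷ zs) y x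
    there  : ∀ {z zs x y} → Consec zs x y → Consec (z ∷ zs) x y

  data At : List V → ℕ → V → Set where
    at-zero : ∀ {x xs} → At (x ∷ xs) zero x
    at-suc  : ∀ {y xs i x} → At xs i x → At (y ∷ xs) (suc i) x

  DistOnPath : List V → V → V → ℕ → Set
  DistOnPath ps x y d = ∃[ i ] ∃[ j ] (At ps i x × At ps j y × d ≡ ∣ i - j ∣)

  _≤lex_ : ℕ × ℕ × ℕ → ℕ × ℕ × ℕ → Set
  (a₁ , a₂ , a₃) ≤lex (b₁ , b₂ , b₃) =
    a₁ < b₁ ⊎ (a₁ ≡ b₁ × (a₂ < b₂ ⊎ (a₂ ≡ b₂ × a₃ ≤ b₃)))

  -- Indices are shifted by one
  -- w.r.t. the paper: vs 0, ts 0, P 0 are v₁, t₁, P¹.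

  module ConnTree (HV : V → Set) (𝒱 : V → Set)
                  (vs ts : ℕ → V) (P : ℕ → List V) where

    Used : ℕ → V → Set
    Used k w = ∃[ i ] (i < k × vs i ≡ w)

    OnUnion : ℕ → V → Set
    OnUnion k u = ∃[ i ] (i < k × u ∈ P i)

    Admissible : ℕ → List V → V → V → Set
    Admissible k Q w u =
      IsPathIn HV Q w u × 𝒱 w × ¬ Used k w × OnUnion k u

    IsGrade : ℕ → List V → V → ℕ × ℕ × ℕ → Set
    IsGrade k Q u (g₁ , g₂ , g₃) =
      g₁ ≡ pathLength Q
      × (g₂ < k × u ∈ P g₂ × (∀ i → i < g₂ → u ∉ P i))
      × DistOnPath (P g₂) u (ts g₂) g₃

    IsConnectingTree : Set
    IsConnectingTree =
      𝒱 (vs 0) × P 0 ≡ vs 0 ∷ [] × ts 0 ≡ vs 0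
      × (∀ k → Admissible (suc k) (P (suc k)) (vs (suc k)) (ts (suc k))
             × ∃[ g ] (IsGrade (suc k) (P (suc k)) (ts (suc k)) g
                × (∀ Q w u g′ → Admissible (suc k) Q w u
                     → IsGrade (suc k) Q u g′ → g ≤lex g′)))

    TAdj : V → V → Set
    TAdj x y = ∃[ k ] Consec (P k) x y

    TInfiniteDegree : V → Set
    TInfiniteDegree x = InfiniteSet (TAdj x)

  -- G contains an induced subgraph isomorphic to a member of Θ∞:
  -- distinct vertices a, b and pairwise distinct, internally disjoint
  -- a–b paths Q 0, Q 1, …, such that every edge of G between vertices
  -- of their union is an edge of one of the paths.
  HasInducedThetaInf : Set
  HasInducedThetaInf =
    ∃[ a ] ∃[ b ] Σ (ℕ → List V) λ Q →
      a ≢ b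
      × (∀ n → IsPath (Q n) a b)
      × (∀ n m → n ≢ m → Q n ≢ Q m)
      × (∀ n m x → n ≢ m → x ∈ Q n → x ∈ Q m → x ≡ a ⊎ x ≡ b)
      × (∀ n m x y → x ∈ Q n → y ∈ Q m → Adj x y
           → ∃[ k ] Consec (Q k) x y)

module Submission where

-- Each path P (suc k) of the connecting tree is a shortest admissible path.  Hence it is induced,
-- all its vertices except the endpoint are new, and an edge from one of its vertices to an earlier
-- path only occurs at the last two vertices (a detour through a later penultimate vertex y also
-- only reaches its last three vertices).  Infinitely many paths contain a tree edge at x; x is then
-- their common endpoint and their penultimate vertices y are pairwise distinct.  Ramsey's theorem
-- with the absence of an induced K∞ makes the y independent along a subsequence, and a second
-- application decides whether every later y is adjacent to the predecessor z of every earlier y,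
-- or none is.  In the first case x, z and the later y form a Θ∞ of paths of length two.  In the
-- second, the routes from v to its last neighbour w on each path (other than x) and then along the
-- path to x form an induced Θ∞, together with the edge v x if it exists.

open import Defs
open import Level using (0ℓ)
open import Axiom.ExcludedMiddle using (ExcludedMiddle)
open import Data.Bool using (Bool; true; false)
open import Data.Empty using (⊥-elim)
open import Data.Fin using (Fin; toℕ)
import Data.Fin.Properties as Fin
open import Data.List using (List; []; _∷_; length; head; last; take; drop; _++_; concat; applyUpTo)
open import Data.List.Properties using (length-++; length-take; length-drop)
open import Data.List.Membership.Propositional using (_∈_; _∉_)
open import Data.List.Membership.Propositional.Properties using (∈-++⁻; ∈-concat⁺′; ∈-applyUpTo⁺)
import Data.List.Membership.Setoid.Properties as SetoidMembership
open import Data.List.Relation.Binary.Disjoint.Propositional using (Disjoint)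
open import Data.List.Relation.Unary.All as All using (All; []; _∷_)
open import Data.List.Relation.Unary.AllPairs using ([]; _∷_)
open import Data.List.Relation.Unary.Any as Any using (here; there)
open import Data.List.Relation.Unary.Linked using (Linked; []; [-]; _∷_)
import Data.List.Relation.Unary.Linked.Properties as Linked
open import Data.List.Relation.Unary.Unique.Propositional using (Unique)
import Data.List.Relation.Unary.Unique.Propositional.Properties as Unique
open import Data.Maybe using (Maybe; just; nothing)
open import Data.Maybe.Properties using (just-injective)
open import Data.Maybe.Relation.Binary.Connected using (just) renaming (Connected to MaybeConnected)
open import Data.Nat
open import Data.Nat.Induction using (<-rec)
open import Data.Nat.Properties
open import Data.Product
open import Data.Sum using (_⊎_; inj₁; inj₂; [_,_]′) renaming (map to map-⊎; map₁ to map₁-⊎)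
open import Data.Unit using (⊤; tt)
open import Function using (_∘_)
open import Function.Definitions using (Injective)
open import Relation.Binary.Definitions using (tri<; tri≈; tri>)
open import Relation.Binary.PropositionalEquality
open import Relation.Nullary
open import Relation.Nullary.Decidable using (decidable-stable)

module Positions (G : Graph) where
  open Graph G using (V; Adj)

  private
    variable
      xs : List V
      i j n : ℕ
      x y : V

  at⇒∈ : At G xs i x → x ∈ xs
  at⇒∈ at-zero    = here refl
  at⇒∈ (at-suc a) = there (at⇒∈ a)

  ∈⇒at : x ∈ xs → ∃[ i ] At G xs i x
  ∈⇒at (here refl) = 0 , at-zero
  ∈⇒at (there m)   = map suc at-suc (∈⇒at m)

  at⇒< : At G xs i x → i < length xs
  at⇒< at-zero    = s≤s z≤n
  at⇒< (at-suc a) = s≤s (at⇒< a)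

  at-exists : ∀ xs → i < length xs → ∃[ x ] At G xs i x
  at-exists {zero}  (x ∷ xs) _       = x , at-zero
  at-exists {suc i} (x ∷ xs) (s≤s p) = map₂ at-suc (at-exists xs p)

  at-functional : At G xs i x → At G xs i y → x ≡ y
  at-functional at-zero    at-zero    = refl
  at-functional (at-suc a) (at-suc b) = at-functional a b

  at-injective : Unique xs → At G xs i x → At G xs j x → i ≡ j
  at-injective _        at-zero    at-zero    = refl
  at-injective (x∉ ∷ _) at-zero    (at-suc b) = ⊥-elim (All.lookup x∉ (at⇒∈ b) refl)
  at-injective (x∉ ∷ _) (at-suc a) at-zero    = ⊥-elim (All.lookup x∉ (at⇒∈ a) refl)
  at-injective (_ ∷ u)  (at-suc a) (at-suc b) = cong suc (at-injective u a b)

  at-take : At G xs i x → i < n → At G (take n xs) i x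
  at-take {n = suc n} at-zero    _       = at-zero
  at-take {n = suc n} (at-suc a) (s≤s p) = at-suc (at-take a p)

  take-at : At G (take n xs) i x → At G xs i x × i < n
  take-at {n = suc n} {_ ∷ _} at-zero    = at-zero , s≤s z≤n
  take-at {n = suc n} {_ ∷ _} (at-suc a) = map at-suc s≤s (take-at a)

  at-drop : At G xs i x → n ≤ i → At G (drop n xs) (i ∸ n) x
  at-drop {n = zero}  a          _       = a
  at-drop {n = suc n} (at-suc a) (s≤s p) = at-drop a p

  drop-at : At G (drop n xs) i x → At G xs (n + i) x
  drop-at {n = zero}           a = a
  drop-at {n = suc n} {_ ∷ _}  a = at-suc (drop-at a)

  head⇒at : head xs ≡ just x → At G xs 0 x
  head⇒at {_ ∷ _} refl = at-zero

  at⇒head : At G xs 0 x → head xs ≡ just x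
  at⇒head at-zero = refl

  at⇒head-drop : At G xs i x → head (drop i xs) ≡ just x
  at⇒head-drop at-zero    = refl
  at⇒head-drop (at-suc a) = at⇒head-drop a

  last⇒at : last xs ≡ just x → At G xs (length xs ∸ 1) x
  last⇒at {_ ∷ []}     refl = at-zero
  last⇒at {_ ∷ _ ∷ _}  e    = at-suc (last⇒at e)

  at⇒last : At G xs i x → suc i ≡ length xs → last xs ≡ just x
  at⇒last {_ ∷ []}    at-zero    _ = refl
  at⇒last {_ ∷ _ ∷ _} (at-suc a) e = at⇒last a (suc-injective e)

  last-drop : ∀ (xs : List V) → i < length xs → last (drop i xs) ≡ last xs
  last-drop {zero}  _            _         = refl
  last-drop {suc i} (_ ∷ []) (s≤s ())
  last-drop {suc i} (_ ∷ y ∷ ys) (s≤s i<) = last-drop (y ∷ ys) i<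

  last-++ : ∀ xs {ys : List V} → last ys ≡ just y → last (xs ++ ys) ≡ just y
  last-++ []            e = e
  last-++ (_ ∷ [])      {ys = _ ∷ _} e = e
  last-++ (_ ∷ x′ ∷ xs) e = last-++ (x′ ∷ xs) e

  head-++ : ∀ {xs} (ys : List V) → head xs ≡ just x → head (xs ++ ys) ≡ just x
  head-++ {xs = _ ∷ _} _ e = e

  at-linked : Linked Adj xs → At G xs i x → At G xs (suc i) y → Adj x y
  at-linked (r ∷ _) at-zero    (at-suc at-zero) = r
  at-linked (_ ∷ l) (at-suc a) (at-suc b)       = at-linked l a b

  linked-take : ∀ n → Linked Adj xs → Linked Adj (take n xs)
  linked-take zero          _       = []
  linked-take (suc n)       []      = []
  linked-take (suc zero)    [-]     = [-]
  linked-take (suc (suc n)) [-]     = [-]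
  linked-take (suc zero)    (_ ∷ _) = [-]
  linked-take (suc (suc n)) (r ∷ l) = r ∷ linked-take (suc n) l

  linked-drop : ∀ n → Linked Adj xs → Linked Adj (drop n xs)
  linked-drop zero          l       = l
  linked-drop (suc n)       []      = []
  linked-drop (suc zero)    [-]     = []
  linked-drop (suc (suc n)) [-]     = []
  linked-drop (suc n)       (_ ∷ l) = linked-drop n l

  at⇒consec : At G xs i x → At G xs (suc i) y → Consec G xs x y
  at⇒consec at-zero    (at-suc at-zero) = here-→
  at⇒consec (at-suc a) (at-suc b)       = there (at⇒consec a b)

  consec-sym : Consec G xs x y → Consec G xs y x
  consec-sym here-→    = here-←
  consec-sym here-←    = here-→
  consec-sym (there c) = there (consec-sym c)

  consec⇒∈ : Consec G xs x y → x ∈ xs × y ∈ xs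
  consec⇒∈ here-→    = here refl , there (here refl)
  consec⇒∈ here-←    = there (here refl) , here refl
  consec⇒∈ (there c) = map there there (consec⇒∈ c)

  consec⇒2≤length : Consec G xs x y → 2 ≤ length xs
  consec⇒2≤length here-→    = s≤s (s≤s z≤n)
  consec⇒2≤length here-←    = s≤s (s≤s z≤n)
  consec⇒2≤length (there c) = m≤n⇒m≤1+n (consec⇒2≤length c)

  take-drop-disjoint : Unique xs → i < j → Disjoint (take i xs) (drop j xs)
  take-drop-disjoint u i<j (x∈take , x∈drop) with ∈⇒at x∈take | ∈⇒at x∈drop
  ... | a , at₁ | b , at₂ with take-at at₁
  ... | at₁′ , a<i = <-irrefl (at-injective u at₁′ (drop-at at₂))
                              (<-≤-trans (<-trans a<i i<j) (m≤m+n _ b))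

  length-take-at : At G xs i x → length (take (suc i) xs) ≡ suc i
  length-take-at {xs} {i} a = trans (length-take (suc i) xs) (m≤n⇒m⊓n≡m (at⇒< a))

  ∈-take⇒∈ : ∀ n → x ∈ take n xs → x ∈ xs
  ∈-take⇒∈ n m = at⇒∈ (proj₁ (take-at (proj₂ (∈⇒at m))))

  ∈-drop⇒∈ : ∀ n → x ∈ drop n xs → x ∈ xs
  ∈-drop⇒∈ n m = at⇒∈ (drop-at {n = n} (proj₂ (∈⇒at m)))

module Paths (G : Graph) where
  open Graph G using (V; Adj)
  open Positions G

  private
    variable
      S : V → Set
      xs ys : List V
      a b c d p q : V
      i : ℕ

  prefix-path : IsPathIn G S xs a b → At G xs i p → IsPathIn G S (take (suc i) xs) a p
  prefix-path {i = i} (l , u , h , _ , s) p-at =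
    linked-take (suc i) l , Unique.take⁺ (suc i) u ,
    at⇒head (at-take (head⇒at h) (s≤s z≤n)) ,
    at⇒last (at-take p-at ≤-refl) (sym (length-take-at p-at)) ,
    λ m → s (∈-take⇒∈ (suc i) m)

  suffix-path : IsPathIn G S xs a b → At G xs i q → IsPathIn G S (drop i xs) q b
  suffix-path {xs = xs} {i = i} (l , u , _ , t , s) q-at =
    linked-drop i l , Unique.drop⁺ i u , at⇒head-drop q-at ,
    trans (last-drop xs (at⇒< q-at)) t , λ m → s (∈-drop⇒∈ i m)

  ++-path : IsPathIn G S xs a b → IsPathIn G S ys c d → Adj b c → Disjoint xs ys
          → IsPathIn G S (xs ++ ys) a d
  ++-path {xs = xs} {ys = ys} (l , u , h , t , s) (l′ , u′ , h′ , t′ , s′) b~c disj =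
    Linked.++⁺ l (connect t h′ b~c) l′ , Unique.++⁺ u u′ disj ,
    head-++ ys h , last-++ xs t′ , [ s , s′ ]′ ∘ ∈-++⁻ xs
    where
    connect : last xs ≡ just b → head ys ≡ just c → Adj b c
            → MaybeConnected Adj (last xs) (head ys)
    connect e e′ r rewrite e | e′ = just r

  [-]-path : S a → IsPathIn G S (a ∷ []) a a
  [-]-path s = [-] , [] ∷ [] , refl , refl , λ { (here refl) → s }

  path-forget : IsPathIn G S xs a b → IsPath G xs a b
  path-forget (l , u , h , t , _) = l , u , h , t , λ _ → tt

  ≤-pathLength⇒≤-length : ∀ {ys} → head ys ≡ just c → pathLength G xs ≤ pathLength G ys
                        → length xs ≤ length ys
  ≤-pathLength⇒≤-length {xs = xs} {ys = _ ∷ _} _ le = ≤-trans (m≤n+m∸n (length xs) 1) (s≤s le)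

StrictlyIncreasing : (ℕ → ℕ) → Set
StrictlyIncreasing h = ∀ {i j} → i < j → h i < h j

strictlyIncreasing-step : ∀ h → (∀ i → h i < h (suc i)) → StrictlyIncreasing h
strictlyIncreasing-step h step {i} {suc j} (s≤s i≤j) with m≤n⇒m<n∨m≡n i≤j
... | inj₁ i<j  = <-trans (strictlyIncreasing-step h step i<j) (step j)
... | inj₂ refl = step i

strictlyIncreasing-∘ : ∀ {g h} → StrictlyIncreasing g → StrictlyIncreasing h
                     → StrictlyIncreasing (g ∘ h)
strictlyIncreasing-∘ g↑ h↑ = g↑ ∘ h↑

strictlyIncreasing⇒injective : ∀ {h} → StrictlyIncreasing h → Injective _≡_ _≡_ h
strictlyIncreasing⇒injective h↑ {i} {j} e with <-cmp i j
... | tri< i<j _ _ = contradiction e (<⇒≢ (h↑ i<j))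
... | tri≈ _ i≡j _ = i≡j
... | tri> _ _ j<i = contradiction e (≢-sym (<⇒≢ (h↑ j<i)))

Unbounded : (ℕ → Set) → Set
Unbounded A = ∀ n → ∃[ m ] (n ≤ m × A m)

unbounded⇒subsequence : ∀ {A} → Unbounded A → ∃[ h ] (StrictlyIncreasing h × (∀ i → A (h i)))
unbounded⇒subsequence {A} unb = h , strictlyIncreasing-step h (λ i → proj₁ (proj₂ (next i))) , A-h
  where
  h : ℕ → ℕ
  next : ∀ i → ∃[ m ] (suc (h i) ≤ m × A m)
  h zero    = proj₁ (unb 0)
  h (suc i) = proj₁ (next i)
  next i = unb (suc (h i))
  A-h : ∀ i → A (h i)
  A-h zero    = proj₂ (proj₂ (unb 0))
  A-h (suc i) = proj₂ (proj₂ (next i))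

module Classical (em : ExcludedMiddle 0ℓ) where

  ¬∀⇒∃¬ : ∀ {B : ℕ → Set} → ¬ (∀ n → B n) → ∃[ n ] ¬ B n
  ¬∀⇒∃¬ {B} ¬∀ with em {∃[ n ] ¬ B n}
  ... | yes ∃¬ = ∃¬
  ... | no ¬∃¬ = ⊥-elim (¬∀ λ n → decidable-stable (em {B n}) (λ ¬b → ¬∃¬ (n , ¬b)))

  least : (Q : ℕ → Set) → ∀ {n} → Q n → ∃[ m ] (m ≤ n × Q m × (∀ {j} → j < m → ¬ Q j))
  least Q {n} = <-rec Least step n
    where
    Least : ℕ → Set
    Least n = Q n → ∃[ m ] (m ≤ n × Q m × (∀ {j} → j < m → ¬ Q j))
    step : ∀ n → (∀ {j} → j < n → Least j) → Least n
    step n rec qn with em {∃[ j ] (j < n × Q j)}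
    ... | yes (j , j<n , qj) = let m , m≤j , rest = rec j<n qj in m , ≤-trans m≤j (<⇒≤ j<n) , rest
    ... | no none            = n , ≤-refl , qn , λ j<n qj → none (_ , j<n , qj)

  greatest : (D : ℕ → Set) → D 0 → ∀ b → ∃[ c ] (c ≤ b × D c × (∀ {e} → c < e → e ≤ b → ¬ D e))
  greatest D d₀ zero = 0 , z≤n , d₀ , λ 0<e e≤0 → contradiction e≤0 (<⇒≱ 0<e)
  greatest D d₀ (suc b) with em {D (suc b)}
  ... | yes d = suc b , ≤-refl , d , λ b<e e≤b → contradiction e≤b (<⇒≱ b<e)
  ... | no ¬d = let c , c≤b , dc , above = greatest D d₀ b in
                c , m≤n⇒m≤1+n c≤b , dc , λ c<e e≤1+b → [ above c<e ∘ s≤s⁻¹ , (λ { refl → ¬d }) ]′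
                                                        (m≤n⇒m<n∨m≡n e≤1+b)

  unbounded-split : ∀ {A} (B : ℕ → Set) → Unbounded A
                  → Unbounded (λ m → A m × B m) ⊎ Unbounded (λ m → A m × ¬ B m)
  unbounded-split {A} B unb with em {Unbounded (λ m → A m × B m)}
  ... | yes unbB = inj₁ unbB
  ... | no ¬unbB = inj₂ λ n →
    let N , noB = ¬∀⇒∃¬ ¬unbB
        m , n⊔N≤m , am = unb (n ⊔ N)
    in m , ≤-trans (m≤m⊔n n N) n⊔N≤m , am ,
       λ bm → noB (m , ≤-trans (m≤n⊔m n N) n⊔N≤m , am , bm)

  injective-escapes : ∀ {X : Set} {f : ℕ → X} → Injective _≡_ _≡_ f → ∀ L → ∃[ n ] f n ∉ L
  injective-escapes {X} {f} f-inj L with em {∃[ n ] f n ∉ L}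
  ... | yes escape = escape
  ... | no ¬escape = ⊥-elim (Fin.<-irrefl i≡j i<j)
    where
    f∈L : ∀ n → f n ∈ L
    f∈L n = decidable-stable (em {f n ∈ L}) (λ f∉ → ¬escape (n , f∉))
    pos : Fin (suc (length L)) → Fin (length L)
    pos k = Any.index (f∈L (toℕ k))
    collision = Fin.pigeonhole (n<1+n (length L)) pos
    i = proj₁ collision
    j = proj₁ (proj₂ collision)
    i<j = proj₁ (proj₂ (proj₂ collision))
    i≡j : i ≡ j
    i≡j = Fin.toℕ-injective (f-inj (SetoidMembership.index-injective (setoid X) _ _
                                        (proj₂ (proj₂ (proj₂ collision)))))

  Colour : Bool → Set → Set
  Colour true  P = P
  Colour false P = ¬ P

  module _ (C : ℕ → ℕ → Set) where

    private
      record Stage : Set₁ where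
        field
          anchor         : ℕ
          colour         : Bool
          pool           : ℕ → Set
          pool-unbounded : Unbounded pool
          pool-coloured  : ∀ {m} → pool m → anchor < m × Colour colour (C anchor m)
      open Stage

      above : ∀ {A : ℕ → Set} → Unbounded A → ∀ a → Unbounded (λ m → A m × a < m)
      above unb a n = let m , le , m∈A = unb (suc a ⊔ n) in
                      m , ≤-trans (m≤n⊔m (suc a) n) le , m∈A , ≤-trans (m≤m⊔n (suc a) n) le

      refine : ∀ {A : ℕ → Set} → Unbounded A → Σ[ s ∈ Stage ] (A (anchor s) × (∀ {m} → pool s m → A m))
      refine {A} unb = from (unbounded-split (C a) (above unb a))
        where
        a = proj₁ (unb 0)
        stage : ∀ c → Unbounded (λ m → (A m × a < m) × Colour c (C a m)) → Stage
        stage c u = record { anchor = a ; colour = c ; pool = λ m → (A m × a < m) × Colour c (C a m)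
                           ; pool-unbounded = u ; pool-coloured = map₁ proj₂ }
        from : Unbounded (λ m → (A m × a < m) × C a m) ⊎ Unbounded (λ m → (A m × a < m) × ¬ C a m)
             → Σ[ s ∈ Stage ] (A (anchor s) × (∀ {m} → pool s m → A m))
        from (inj₁ u) = stage true  u , proj₂ (proj₂ (unb 0)) , proj₁ ∘ proj₁
        from (inj₂ u) = stage false u , proj₂ (proj₂ (unb 0)) , proj₁ ∘ proj₁

      stages : ℕ → Stage
      stages zero    = proj₁ (refine {λ _ → ⊤} (λ n → n , ≤-refl , tt))
      stages (suc n) = proj₁ (refine (pool-unbounded (stages n)))

      pool-antitone : ∀ {i j m} → i ≤ j → pool (stages j) m → pool (stages i) m
      pool-antitone {j = zero}  z≤n m∈ = m∈
      pool-antitone {i} {suc j} i≤1+j m∈ with m≤n⇒m<n∨m≡n i≤1+j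
      ... | inj₁ i≤j = pool-antitone (s≤s⁻¹ i≤j) (proj₂ (proj₂ (refine (pool-unbounded (stages j)))) m∈)
      ... | inj₂ refl = m∈

      anchors-coloured : ∀ {i j} → i < j → anchor (stages i) < anchor (stages j)
                       × Colour (colour (stages i)) (C (anchor (stages i)) (anchor (stages j)))
      anchors-coloured {i} {suc j} (s≤s i≤j) =
        pool-coloured (stages i) (pool-antitone i≤j (proj₁ (proj₂ (refine (pool-unbounded (stages j))))))

      some-colour-unbounded : ∃[ c ] Unbounded (λ i → colour (stages i) ≡ c)
      some-colour-unbounded with unbounded-split (λ i → colour (stages i) ≡ true) (λ n → n , ≤-refl , tt)
      ... | inj₁ unb = true , λ n → map₂ (map₂ proj₂) (unb n)
      ... | inj₂ unb = false , λ n → map₂ (map₂ (not-true ∘ proj₂)) (unb n)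
        where
        not-true : ∀ {b} → b ≢ true → b ≡ false
        not-true {false} _ = refl
        not-true {true}  b≢ = contradiction refl b≢

      homogeneous : ∃[ c ] ∃[ h ] (StrictlyIncreasing h × (∀ {i j} → i < j → Colour c (C (h i) (h j))))
      homogeneous =
        let c , unb = some-colour-unbounded
            e , e↑ , e-c = unbounded⇒subsequence unb
        in c , anchor ∘ stages ∘ e , proj₁ ∘ anchors-coloured ∘ e↑ ,
           λ {i} {j} i<j → subst (λ c′ → Colour c′ (C (anchor (stages (e i))) (anchor (stages (e j)))))
                                 (e-c i) (proj₂ (anchors-coloured (e↑ i<j)))

    ramsey : ∃[ h ] (StrictlyIncreasing h × ((∀ {i j} → i < j → C (h i) (h j))
                                             ⊎ (∀ {i j} → i < j → ¬ C (h i) (h j))))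
    ramsey with homogeneous
    ... | true  , h , h↑ , hom = h , h↑ , inj₁ hom
    ... | false , h , h↑ , hom = h , h↑ , inj₂ hom

module ConnectingTreeProperties
  (em : ExcludedMiddle 0ℓ) (G : Graph) (H 𝒱 : Graph.V G → Set)
  (vs ts : ℕ → Graph.V G) (P : ℕ → List (Graph.V G))
  (tree : ConnTree.IsConnectingTree G H 𝒱 vs ts P) (v₁∈H : H (vs 0)) where

  open Graph G using (V; Adj) renaming (sym to Adj-sym)
  open ConnTree G H 𝒱 vs ts P
  open Positions G
  open Paths G
  open Classical em using (least)

  private
    variable
      i j k : ℕ
      p q u y : V

  P-admissible : ∀ k → Admissible (suc k) (P (suc k)) (vs (suc k)) (ts (suc k))
  P-admissible k = proj₁ (proj₂ (proj₂ (proj₂ tree)) k)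

  P-path : ∀ k → IsPathIn G H (P (suc k)) (vs (suc k)) (ts (suc k))
  P-path k = proj₁ (P-admissible k)

  ts-old : ∀ k → OnUnion (suc k) (ts (suc k))
  ts-old k = proj₂ (proj₂ (proj₂ (P-admissible k)))

  ts∈P : ∀ i → ts i ∈ P i
  ts∈P zero    rewrite proj₁ (proj₂ tree) | proj₁ (proj₂ (proj₂ tree)) = here refl
  ts∈P (suc k) = at⇒∈ (last⇒at (proj₁ (proj₂ (proj₂ (proj₂ (P-path k))))))

  P⊆H : ∀ i → u ∈ P i → H u
  P⊆H zero    u∈ rewrite proj₁ (proj₂ tree) with u∈
  ... | here refl = v₁∈H
  P⊆H (suc k) = proj₂ (proj₂ (proj₂ (proj₂ (P-path k))))

  OnUnion⇒H : OnUnion k u → H u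
  OnUnion⇒H (i , _ , u∈) = P⊆H i u∈

  grade-exists : ∀ k Q → OnUnion k u → ∃[ g ] IsGrade k Q u g
  grade-exists {u} k Q (i , i<k , u∈) with least (λ j → u ∈ P j) u∈
  ... | m , m≤i , u∈Pm , earlier with ∈⇒at u∈Pm | ∈⇒at (ts∈P m)
  ... | a , u-at | b , t-at =
    (pathLength G Q , m , ∣ a - b ∣) , refl , (≤-<-trans m≤i i<k , u∈Pm , λ _ → earlier) ,
    a , b , u-at , t-at , refl

  P-shortest : ∀ k {Q w u} → Admissible (suc k) Q w u → length (P (suc k)) ≤ length Q
  P-shortest k {Q} {u = u} Q-adm@((_ , _ , Q-head , _) , _ , _ , u-old)
    with proj₂ (proj₂ (proj₂ (proj₂ tree)) k) | grade-exists (suc k) Q u-old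
  ... | g , (g≡ , _) , minimal | g′ , g′-grade@(g′≡ , _) =
    ≤-pathLength⇒≤-length {xs = P (suc k)} Q-head
      (subst₂ _≤_ g≡ g′≡ (first-≤ (minimal Q _ u g′ Q-adm g′-grade)))
    where
    first-≤ : ∀ {a b} → _≤lex_ G a b → proj₁ a ≤ proj₁ b
    first-≤ (inj₁ lt)      = <⇒≤ lt
    first-≤ (inj₂ (eq , _)) = ≤-reflexive eq

  shortcut-length : ∀ k {i p R c u} → At G (P (suc k)) i p → IsPathIn G H R c u → Adj p c
                  → Disjoint (take (suc i) (P (suc k))) R → OnUnion (suc k) u
                  → length (P (suc k)) ≤ suc i + length R
  shortcut-length k {i} {R = R} p-at R-path p~c disj u-old =
    let _ , v∈𝒱 , v-new , _ = P-admissible k in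
    subst (length (P (suc k)) ≤_) length≡
      (P-shortest k (++-path (prefix-path (P-path k) p-at) R-path p~c disj , v∈𝒱 , v-new , u-old))
    where
    length≡ : length (take (suc i) (P (suc k)) ++ R) ≡ suc i + length R
    length≡ = trans (length-++ (take (suc i) (P (suc k)))) (cong (_+ length R) (length-take-at p-at))

  old⇒last : At G (P (suc k)) i p → OnUnion (suc k) p → length (P (suc k)) ≤ suc i
  old⇒last {k} p-at p-old =
    let _ , v∈𝒱 , v-new , _ = P-admissible k in
    subst (length (P (suc k)) ≤_) (length-take-at p-at)
      (P-shortest k (prefix-path (P-path k) p-at , v∈𝒱 , v-new , p-old))

  old∈prefix⇒short : u ∈ take (suc i) (P (suc k)) → OnUnion (suc k) u → length (P (suc k)) ≤ suc i
  old∈prefix⇒short {i = i} u∈ u-old =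
    let a , u-at = ∈⇒at u∈
        u-at′ , a<1+i = take-at u-at
    in ≤-trans (old⇒last u-at′ u-old) a<1+i

  P-chordless : At G (P (suc k)) i p → At G (P (suc k)) j q → Adj p q → j ≤ suc i
  P-chordless {k} {i} {j = j} p-at q-at p~q with j ≤? suc i
  ... | yes j≤1+i = j≤1+i
  ... | no  j≰1+i = contradiction (+-cancelˡ-≤ (L ∸ j) _ _ (begin
      L ∸ j + j          ≡⟨ m∸n+n≡m (<⇒≤ (at⇒< q-at)) ⟩
      L                  ≤⟨ shortcut-length k p-at (suffix-path (P-path k) q-at) p~q disj (ts-old k) ⟩
      suc i + length R   ≡⟨ cong (suc i +_) (length-drop j (P (suc k))) ⟩
      suc i + (L ∸ j)    ≡⟨ +-comm (suc i) (L ∸ j) ⟩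
      L ∸ j + suc i      ∎)) j≰1+i
    where
    open ≤-Reasoning
    L = length (P (suc k))
    R = drop j (P (suc k))
    disj : Disjoint (take (suc i) (P (suc k))) R
    disj = take-drop-disjoint (proj₁ (proj₂ (P-path k))) (≰⇒> j≰1+i)

  old-neighbour⇒short : At G (P (suc k)) i p → OnUnion (suc k) q → Adj p q
                      → length (P (suc k)) ≤ 2 + i
  old-neighbour⇒short {k} {i} {q = q} p-at q-old p~q with em {q ∈ take (suc i) (P (suc k))}
  ... | yes q∈ = m≤n⇒m≤1+n (old∈prefix⇒short q∈ q-old)
  ... | no  q∉ = ≤-trans (shortcut-length k p-at ([-]-path (OnUnion⇒H q-old)) p~q disj q-old)
                         (≤-reflexive (+-comm (suc i) 1))
    where
    disj : Disjoint (take (suc i) (P (suc k))) (q ∷ [])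
    disj (q∈ , here refl) = q∉ q∈

  detour⇒short : At G (P (suc k)) i p → H y → y ∉ P (suc k) → Adj p y → Adj y (ts (suc k))
               → length (P (suc k)) ≤ 3 + i
  detour⇒short {k} {i} {y = y} p-at y∈H y∉P p~y y~t with em {ts (suc k) ∈ take (suc i) (P (suc k))}
  ... | yes t∈ = ≤-trans (old∈prefix⇒short t∈ (ts-old k)) (m≤n+m (suc i) 2)
  ... | no  t∉ = ≤-trans (shortcut-length k p-at R-path p~y disj (ts-old k)) (≤-reflexive (+-comm (suc i) 2))
    where
    R-path : IsPathIn G H (y ∷ ts (suc k) ∷ []) y (ts (suc k))
    R-path = ++-path ([-]-path y∈H) ([-]-path (P⊆H (suc k) (ts∈P (suc k)))) y~t
                     λ { (here refl , here refl) → y∉P (ts∈P (suc k)) }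
    disj : Disjoint (take (suc i) (P (suc k))) (y ∷ ts (suc k) ∷ [])
    disj (y∈ , here refl)         = y∉P (∈-take⇒∈ (suc i) y∈)
    disj (t∈ , there (here refl)) = t∉ t∈

  module _ (x : V) where

    Branch : ℕ → Set
    Branch k = OnUnion (suc k) x × ∃[ y ] Consec G (P (suc k)) x y

    -- Positions ≤ r on P (suc k) are exactly those of the vertices other than x.
    record BranchEnd (k : ℕ) : Set where
      field
        r              : ℕ
        length≡        : length (P (suc k)) ≡ 2 + r
        x-at           : At G (P (suc k)) (suc r) x
        penultimate    : V
        penultimate-at : At G (P (suc k)) r penultimate

    branch-end : Branch k → BranchEnd k
    branch-end {k} (x-old , _ , x~y) = end (∈⇒at (proj₁ (consec⇒∈ x~y)))
      where
      length≡ : ∀ {i} → At G (P (suc k)) i x → length (P (suc k)) ≡ suc i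
      length≡ x-at = ≤-antisym (old⇒last x-at x-old) (at⇒< x-at)
      end : ∃[ i ] At G (P (suc k)) i x → BranchEnd k
      end (zero , x-at) = contradiction (subst (2 ≤_) (length≡ x-at) (consec⇒2≤length x~y)) λ { (s≤s ()) }
      end (suc r , x-at) =
        let y , y-at = at-exists (P (suc k)) (subst (r <_) (sym (length≡ x-at)) (m<n⇒m<1+n (n<1+n r)))
        in record { r = r ; length≡ = length≡ x-at ; x-at = x-at ; penultimate = y ; penultimate-at = y-at }

    module _ {k} (E : BranchEnd k) where
      open BranchEnd E

      ts≡x : ts (suc k) ≡ x
      ts≡x = at-functional (subst (λ n → At G (P (suc k)) n (ts (suc k))) (cong (_∸ 1) length≡)
                                  (last⇒at (proj₁ (proj₂ (proj₂ (proj₂ (P-path k)))))))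
                           x-at

      penultimate~x : Adj penultimate x
      penultimate~x = at-linked (proj₁ (P-path k)) penultimate-at x-at

    module _ {k k′} (E : BranchEnd k) (E′ : BranchEnd k′) (k<k′ : k < k′) where
      open BranchEnd E
      open BranchEnd E′ renaming (r to r′; length≡ to length≡′; penultimate to y′; penultimate-at to y′-at)

      inner-fresh : ∀ {c q} → At G (P (suc k′)) c q → c ≤ r′ → q ∉ P (suc k)
      inner-fresh q-at c≤r′ q∈ =
        <⇒≱ (s≤s c≤r′)
            (s≤s⁻¹ (subst (_≤ suc _) length≡′ (old⇒last q-at (suc k , s≤s k<k′ , q∈))))

      inner-edge : ∀ {a c p q} → At G (P (suc k)) a p → a ≤ r → At G (P (suc k′)) c q → c ≤ r′ → Adj p q
                 → q ≡ y′ × (a ≡ r ⊎ suc a ≡ r)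
      inner-edge {a} {c} {p} {q} p-at a≤r q-at c≤r′ p~q = q≡y′ , a-near-end
        where
        c≡r′ : c ≡ r′
        c≡r′ = ≤-antisym c≤r′ (+-cancelˡ-≤ 2 r′ c (subst (_≤ 2 + c) length≡′
                 (old-neighbour⇒short q-at (suc k , s≤s k<k′ , at⇒∈ p-at) (Adj-sym p~q))))
        q≡y′ : q ≡ y′
        q≡y′ = at-functional (subst (λ n → At G (P (suc k′)) n _) c≡r′ q-at) y′-at
        r≤1+a : r ≤ suc a
        r≤1+a = +-cancelˡ-≤ 2 r (suc a) (subst (_≤ 3 + a) length≡
                  (detour⇒short p-at (P⊆H (suc k′) (at⇒∈ y′-at)) (inner-fresh y′-at ≤-refl)
                     (subst (Adj p) q≡y′ p~q) (subst (Adj y′) (sym (ts≡x E)) (penultimate~x E′))))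
        a-near-end : a ≡ r ⊎ suc a ≡ r
        a-near-end with m≤n⇒m<n∨m≡n a≤r
        ... | inj₁ a<r = inj₂ (≤-antisym a<r r≤1+a)
        ... | inj₂ a≡r = inj₁ a≡r

module InducedSubgraphs (G : Graph) where
  open Graph G using (V; Adj; irrefl) renaming (sym to Adj-sym)
  open Positions G

  clique⇒K∞ : ∀ (g : ℕ → V) → Injective _≡_ _≡_ g → (∀ {i j} → i < j → Adj (g i) (g j))
            → HasInducedKInf G
  clique⇒K∞ g g-inj clique = g , g-inj , adjacent
    where
    adjacent : ∀ i j → i ≢ j → Adj (g i) (g j)
    adjacent i j i≢j with <-cmp i j
    ... | tri< i<j _ _ = clique i<j
    ... | tri≈ _ i≡j _ = contradiction i≡j i≢j
    ... | tri> _ _ j<i = Adj-sym (clique j<i)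

  theta-from-common-neighbours : ∀ {a b} (Y : ℕ → V) → a ≢ b → ¬ Adj a b
    → (∀ n → Adj a (Y n)) → (∀ n → Adj (Y n) b) → Injective _≡_ _≡_ Y → (∀ m n → ¬ Adj (Y m) (Y n))
    → HasInducedThetaInf G
  theta-from-common-neighbours {a} {b} Y a≢b a≁b a~Y Y~b Y-inj Y-indep =
    a , b , Q , a≢b , Q-path , Q-distinct , Q-disjoint , Q-induced
    where
    Q : ℕ → List V
    Q n = a ∷ Y n ∷ b ∷ []
    Q-path : ∀ n → IsPath G (Q n) a b
    Q-path n = (a~Y n ∷ Y~b n ∷ [-])
             , ((λ { refl → irrefl (a~Y n) }) ∷ a≢b ∷ [])
               ∷ ((λ { refl → irrefl (Y~b n) }) ∷ []) ∷ [] ∷ []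
             , refl , refl , λ _ → tt
    Q-distinct : ∀ n m → n ≢ m → Q n ≢ Q m
    Q-distinct n m n≢m Qn≡Qm = n≢m (Y-inj (cong middle Qn≡Qm))
      where
      middle : List V → V
      middle (_ ∷ y ∷ _) = y
      middle _           = a
    Q-disjoint : ∀ n m z → n ≢ m → z ∈ Q n → z ∈ Q m → z ≡ a ⊎ z ≡ b
    Q-disjoint n m z n≢m (here z≡a)                 _                           = inj₁ z≡a
    Q-disjoint n m z n≢m (there (there (here z≡b))) _                           = inj₂ z≡b
    Q-disjoint n m z n≢m (there (here _))           (here z≡a)                  = inj₁ z≡a
    Q-disjoint n m z n≢m (there (here _))           (there (there (here z≡b)))  = inj₂ z≡b
    Q-disjoint n m z n≢m (there (here refl))        (there (here z≡Ym))         = contradiction (Y-inj z≡Ym) n≢m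
    Q-induced : ∀ n m p q → p ∈ Q n → q ∈ Q m → Adj p q → ∃[ k ] Consec G (Q k) p q
    Q-induced n m p q (here refl)                 (here refl)                 p~q = contradiction p~q irrefl
    Q-induced n m p q (here refl)                 (there (here refl))         p~q = m , here-→
    Q-induced n m p q (here refl)                 (there (there (here refl))) p~q = contradiction p~q a≁b
    Q-induced n m p q (there (here refl))         (here refl)                 p~q = n , here-←
    Q-induced n m p q (there (here refl))         (there (here refl))         p~q = contradiction p~q (Y-indep n m)
    Q-induced n m p q (there (here refl))         (there (there (here refl))) p~q = n , there here-→
    Q-induced n m p q (there (there (here refl))) (here refl)                 p~q = contradiction (Adj-sym p~q) a≁b
    Q-induced n m p q (there (there (here refl))) (there (here refl))         p~q = m , there here-←
    Q-induced n m p q (there (there (here refl))) (there (there (here refl))) p~q = contradiction p~q irrefl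

  theta-from-paths : ExcludedMiddle 0ℓ → ∀ {a b} (B : ℕ → List V) → a ≢ b
    → (∀ n → IsPath G (B n) a b)
    → (∀ n m → n ≢ m → B n ≢ B m)
    → (∀ n m z → n ≢ m → z ∈ B n → z ∈ B m → z ≡ a ⊎ z ≡ b)
    → (∀ n → B n ≢ a ∷ b ∷ [])
    → (∀ n m p q → p ∈ B n → q ∈ B m → Adj p q
         → (∃[ k ] Consec G (B k) p q) ⊎ Consec G (a ∷ b ∷ []) p q)
    → HasInducedThetaInf G
  theta-from-paths em {a} {b} B a≢b B-path B-distinct B-disjoint B-long B-induced with em {Adj a b}
  ... | no a≁b = a , b , B , a≢b , B-path , B-distinct , B-disjoint , induced
    where
    induced : ∀ n m p q → p ∈ B n → q ∈ B m → Adj p q → ∃[ k ] Consec G (B k) p q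
    induced n m p q p∈ q∈ p~q with B-induced n m p q p∈ q∈ p~q
    ... | inj₁ edge   = edge
    ... | inj₂ here-→ = contradiction p~q a≁b
    ... | inj₂ here-← = contradiction (Adj-sym p~q) a≁b
    ... | inj₂ (there (there ()))
  ... | yes a~b = a , b , Q , a≢b , Q-path , Q-distinct , Q-disjoint , Q-induced
    where
    Q : ℕ → List V
    Q zero    = a ∷ b ∷ []
    Q (suc n) = B n
    Q-path : ∀ n → IsPath G (Q n) a b
    Q-path zero    = (a~b ∷ [-]) , ((a≢b ∷ []) ∷ [] ∷ []) , refl , refl , λ _ → tt
    Q-path (suc n) = B-path n
    Q-distinct : ∀ n m → n ≢ m → Q n ≢ Q m
    Q-distinct zero    zero    n≢m = contradiction refl n≢m
    Q-distinct zero    (suc m) _   = B-long m ∘ sym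
    Q-distinct (suc n) zero    _   = B-long n
    Q-distinct (suc n) (suc m) n≢m = B-distinct n m (n≢m ∘ cong suc)
    endpoint : ∀ {z} → z ∈ a ∷ b ∷ [] → z ≡ a ⊎ z ≡ b
    endpoint (here z≡a)         = inj₁ z≡a
    endpoint (there (here z≡b)) = inj₂ z≡b
    Q-disjoint : ∀ n m z → n ≢ m → z ∈ Q n → z ∈ Q m → z ≡ a ⊎ z ≡ b
    Q-disjoint zero    _       z _   z∈ _  = endpoint z∈
    Q-disjoint (suc n) zero    z _   _  z∈ = endpoint z∈
    Q-disjoint (suc n) (suc m) z n≢m       = B-disjoint n m z (n≢m ∘ cong suc)
    on-some-B : ∀ n {z} → z ∈ Q n → ∃[ k ] z ∈ B k
    on-some-B zero    (here refl)         = 0 , at⇒∈ (head⇒at (proj₁ (proj₂ (proj₂ (B-path 0)))))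
    on-some-B zero    (there (here refl)) = 0 , at⇒∈ (last⇒at (proj₁ (proj₂ (proj₂ (proj₂ (B-path 0))))))
    on-some-B (suc n) z∈                  = n , z∈
    Q-induced : ∀ n m p q → p ∈ Q n → q ∈ Q m → Adj p q → ∃[ k ] Consec G (Q k) p q
    Q-induced n m p q p∈ q∈ p~q
      with on-some-B n p∈ | on-some-B m q∈
    ... | n′ , p∈′ | m′ , q∈′ with B-induced n′ m′ p q p∈′ q∈′ p~q
    ... | inj₁ (k , edge) = suc k , edge
    ... | inj₂ edge       = 0 , edge

module BranchSequence
  (em : ExcludedMiddle 0ℓ) (G : Graph) (v : Graph.V G) (𝒱 : Graph.V G → Set)
  (vs ts : ℕ → Graph.V G) (P : ℕ → List (Graph.V G))
  (tree : ConnTree.IsConnectingTree G (λ x → x ≢ v) 𝒱 vs ts P)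
  (v~𝒱 : ∀ x → 𝒱 x → Graph.Adj G v x) (x : Graph.V G) where

  open Graph G using (V; Adj; irrefl) renaming (sym to Adj-sym)
  open ConnTree G (λ x → x ≢ v) 𝒱 vs ts P
  open Positions G
  open Paths G
  open InducedSubgraphs G
  open Classical em using (greatest; injective-escapes)

  v₁≢v : vs 0 ≢ v
  v₁≢v refl = irrefl (v~𝒱 _ (proj₁ tree))

  open ConnectingTreeProperties em G (λ x → x ≢ v) 𝒱 vs ts P tree v₁≢v public

  branches-unbounded : ∀ {f : ℕ → V} → Injective _≡_ _≡_ f → (∀ n → TAdj x (f n)) → Unbounded (Branch x)
  branches-unbounded {f} f-inj x~f N = far (injective-escapes f-inj (concat (applyUpTo P (suc K))))
    where
    j₀ = proj₁ (x~f 0)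
    K = N ⊔ j₀
    early : ∀ {k z} → k ≤ K → z ∈ P k → z ∈ concat (applyUpTo P (suc K))
    early k≤K z∈ = ∈-concat⁺′ z∈ (∈-applyUpTo⁺ P (s≤s k≤K))
    far : ∃[ n ] f n ∉ concat (applyUpTo P (suc K)) → ∃[ k ] (N ≤ k × Branch x k)
    far (n , fn∉) with x~f n
    ... | zero  , edge = contradiction (early z≤n (proj₂ (consec⇒∈ edge))) fn∉
    ... | suc k , edge with K ≤? k
    ...   | no  K≰k = contradiction (early (≰⇒> K≰k) (proj₂ (consec⇒∈ edge))) fn∉
    ...   | yes K≤k = k , ≤-trans (m≤m⊔n N j₀) K≤k
                    , (j₀ , s≤s (≤-trans (m≤n⊔m N j₀) K≤k) , proj₁ (consec⇒∈ (proj₂ (x~f 0))))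
                    , f n , edge

  module _ (b : ℕ → ℕ) (b↑ : StrictlyIncreasing b) (branch : ∀ m → Branch x (b m)) where

    E : ∀ m → BranchEnd x (b m)
    E m = branch-end x (branch m)

    open BranchEnd using (x-at; penultimate-at)

    B : ℕ → List V
    B m = P (suc (b m))

    r : ℕ → ℕ
    r m = BranchEnd.r (E m)

    y : ℕ → V
    y m = BranchEnd.penultimate (E m)

    y-injective : Injective _≡_ _≡_ y
    y-injective {m} {m′} y≡ with <-cmp m m′
    ... | tri< m<m′ _ _ = contradiction (subst (_∈ B m) y≡ (at⇒∈ (penultimate-at (E m))))
                            (inner-fresh x (E m) (E m′) (b↑ m<m′) (penultimate-at (E m′)) ≤-refl)
    ... | tri≈ _ m≡m′ _ = m≡m′
    ... | tri> _ _ m′<m = contradiction (subst (_∈ B m′) (sym y≡) (at⇒∈ (penultimate-at (E m′))))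
                            (inner-fresh x (E m′) (E m) (b↑ m′<m) (penultimate-at (E m)) ≤-refl)

    y-independent : (∀ {i j} → i < j → ¬ Adj (y i) (y j)) → ∀ i j → ¬ Adj (y i) (y j)
    y-independent indep i j y~y with <-cmp i j
    ... | tri< i<j _ _ = indep i<j y~y
    ... | tri≈ _ refl _ = irrefl y~y
    ... | tri> _ _ j<i = indep j<i (Adj-sym y~y)

    AdjToPredecessor : ℕ → ℕ → Set
    AdjToPredecessor m m′ = ∃[ i ] ∃[ z ] (suc i ≡ r m × At G (B m) i z × Adj (y m′) z)

    theta-via-common-neighbours : (∀ {i j} → i < j → ¬ Adj (y i) (y j))
                                → (∀ {i j} → i < j → AdjToPredecessor i j) → HasInducedThetaInf G
    theta-via-common-neighbours indep bad with bad {0} {1} (s≤s z≤n)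
    ... | i , z , 1+i≡r , z-at , _ =
      theta-from-common-neighbours {x} {z} (y ∘ suc) x≢z x≁z
        (λ n → Adj-sym (penultimate~x x (E (suc n)))) y~z
        (suc-injective ∘ y-injective) (λ m n → y-independent indep (suc m) (suc n))
      where
      x-at′ : At G (B 0) (suc (suc i)) x
      x-at′ = subst (λ n → At G (B 0) (suc n) x) (sym 1+i≡r) (x-at (E 0))
      x≢z : x ≢ z
      x≢z x≡z = <-irrefl (sym (at-injective (proj₁ (proj₂ (P-path (b 0)))) x-at′
                                            (subst (At G (B 0) i) (sym x≡z) z-at)))
                         (m<n⇒m<1+n (n<1+n i))
      x≁z : ¬ Adj x z
      x≁z x~z = <-irrefl refl (s≤s⁻¹ (P-chordless z-at x-at′ (Adj-sym x~z)))
      y~z : ∀ n → Adj (y (suc n)) z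
      y~z n with bad {0} {suc n} (s≤s z≤n)
      ... | i′ , z′ , 1+i′≡r , z′-at , y~z′ = subst (Adj (y (suc n))) z′≡z y~z′
        where
        z′≡z : z′ ≡ z
        z′≡z = at-functional (subst (λ j → At G (B 0) j z′) (suc-injective (trans 1+i′≡r (sym 1+i≡r))) z′-at)
                             z-at

    NeighbourOfV : ℕ → ℕ → Set
    NeighbourOfV m e = ∃[ p ] (At G (B m) e p × Adj v p)

    -- The route through branch m leaves v at its last neighbour on B m other than x.
    exit : ∀ m → ∃[ c ] (c ≤ r m × NeighbourOfV m c × (∀ {e} → c < e → e ≤ r m → ¬ NeighbourOfV m e))
    exit m = greatest (NeighbourOfV m) (vs (suc (b m)) , start , v~𝒱 _ (proj₁ (proj₂ (P-admissible (b m)))))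
                      (r m)
      where start = head⇒at (proj₁ (proj₂ (proj₂ (P-path (b m)))))

    c : ℕ → ℕ
    c m = proj₁ (exit m)

    w : ℕ → V
    w m = proj₁ (proj₁ (proj₂ (proj₂ (exit m))))

    w-at : ∀ m → At G (B m) (c m) (w m)
    w-at m = proj₁ (proj₂ (proj₁ (proj₂ (proj₂ (exit m)))))

    c≤r : ∀ m → c m ≤ r m
    c≤r m = proj₁ (proj₂ (exit m))

    route : ℕ → List V
    route m = v ∷ drop (c m) (B m)

    route-path : ∀ m → IsPath G (route m) v x
    route-path m = subst (IsPath G (route m) v) (ts≡x x (E m))
      (++-path ([-]-path tt) (path-forget (suffix-path (P-path (b m)) (w-at m)))
               (proj₂ (proj₂ (proj₁ (proj₂ (proj₂ (exit m)))))) v∉tail)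
      where
      v∉tail : Disjoint (v ∷ []) (drop (c m) (B m))
      v∉tail (here refl , v∈) = P⊆H (suc (b m)) (∈-drop⇒∈ (c m) v∈) refl

    ∈-route-tail : ∀ m {z} → z ∈ drop (c m) (B m) → ∃[ e ] (At G (B m) e z × c m ≤ e)
    ∈-route-tail m z∈ = let a , z-at = ∈⇒at z∈ in c m + a , drop-at z-at , m≤m+n (c m) a

    x-or-inner : ∀ m {e z} → At G (B m) e z → z ≡ x ⊎ e ≤ r m
    x-or-inner m {e} z-at with e ≤? r m
    ... | yes e≤r = inj₂ e≤r
    ... | no  e≰r = inj₁ (at-functional (subst (λ n → At G (B m) n _) e≡1+r z-at) (x-at (E m)))
      where
      e≡1+r : e ≡ suc (r m)
      e≡1+r = ≤-antisym (s≤s⁻¹ (subst (e <_) (BranchEnd.length≡ (E m)) (at⇒< z-at))) (≰⇒> e≰r)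

    route-consec : ∀ m {e p q} → At G (B m) e p → At G (B m) (suc e) q → c m ≤ e → Consec G (route m) p q
    route-consec m {e} {q = q} p-at q-at c≤e =
      there (at⇒consec (at-drop p-at c≤e)
                       (subst (λ n → At G (drop (c m) (B m)) n q) (+-∸-assoc 1 c≤e)
                              (at-drop q-at (m≤n⇒m≤1+n c≤e))))

    route-edge : ∀ m {a e p q} → At G (B m) a p → At G (B m) e q → c m ≤ a → c m ≤ e → Adj p q
               → Consec G (route m) p q
    route-edge m {a} {e} p-at q-at c≤a c≤e p~q with <-cmp a e
    ... | tri< a<e _ _ = route-consec m p-at (subst (λ n → At G (B m) n _) e≡1+a q-at) c≤a
      where e≡1+a = ≤-antisym (P-chordless p-at q-at p~q) a<e
    ... | tri≈ _ refl _ = contradiction (subst (Adj _) (at-functional q-at p-at) p~q) irrefl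
    ... | tri> _ _ e<a = consec-sym (route-consec m q-at (subst (λ n → At G (B m) n _) a≡1+e p-at) c≤e)
      where a≡1+e = ≤-antisym (P-chordless q-at p-at (Adj-sym p~q)) e<a

    v-edge : ∀ m {z} → z ∈ drop (c m) (B m) → Adj v z → Consec G (route m) v z ⊎ Consec G (v ∷ x ∷ []) v z
    v-edge m z∈ v~z with ∈-route-tail m z∈
    ... | e , z-at , c≤e with x-or-inner m z-at
    ...   | inj₁ refl = inj₂ here-→
    ...   | inj₂ e≤r with m≤n⇒m<n∨m≡n c≤e
    ...     | inj₁ c<e  = contradiction (_ , z-at , v~z) (proj₂ (proj₂ (proj₂ (exit m))) c<e e≤r)
    ...     | inj₂ refl = inj₁ (at⇒consec at-zero (at-suc (head⇒at (at⇒head-drop z-at))))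

    second : List V → Maybe V
    second (_ ∷ zs) = head zs
    second []       = nothing

    second-route : ∀ m → second (route m) ≡ just (w m)
    second-route m = at⇒head-drop (w-at m)

    w-fresh : ∀ {n m} → n < m → w m ∉ B n
    w-fresh {n} {m} n<m = inner-fresh x (E n) (E m) (b↑ n<m) (w-at m) (c≤r m)

    route-distinct : ∀ n m → n ≢ m → route n ≢ route m
    route-distinct n m n≢m route≡ with <-cmp n m
    ... | tri< n<m _ _ = w-fresh n<m (subst (_∈ B n) w≡ (at⇒∈ (w-at n)))
      where w≡ = just-injective (trans (sym (second-route n)) (trans (cong second route≡) (second-route m)))
    ... | tri≈ _ n≡m _ = n≢m n≡m
    ... | tri> _ _ m<n = w-fresh m<n (subst (_∈ B m) (sym w≡) (at⇒∈ (w-at m)))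
      where w≡ = just-injective (trans (sym (second-route n)) (trans (cong second route≡) (second-route m)))

    route-long : ∀ m → route m ≢ v ∷ x ∷ []
    route-long m route≡ = <⇒≢ (s≤s (c≤r m)) (at-injective (proj₁ (proj₂ (P-path (b m)))) (w-at m)
                            (subst (At G (B m) (suc (r m))) (sym w≡x) (x-at (E m))))
      where w≡x = just-injective (trans (sym (second-route m)) (cong second route≡))

    route-disjoint : ∀ n m z → n ≢ m → z ∈ route n → z ∈ route m → z ≡ v ⊎ z ≡ x
    route-disjoint n m z n≢m (here z≡v) _          = inj₁ z≡v
    route-disjoint n m z n≢m (there _)  (here z≡v) = inj₁ z≡v
    route-disjoint n m z n≢m (there zn) (there zm)
      with ∈-route-tail n zn | ∈-route-tail m zm
    ... | a , z-at , _ | e , z-at′ , _ with x-or-inner n z-at | x-or-inner m z-at′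
    ...   | inj₁ z≡x | _        = inj₂ z≡x
    ...   | inj₂ _   | inj₁ z≡x = inj₂ z≡x
    ...   | inj₂ a≤r | inj₂ e≤r with <-cmp n m
    ...     | tri< n<m _ _ = contradiction (at⇒∈ z-at) (inner-fresh x (E n) (E m) (b↑ n<m) z-at′ e≤r)
    ...     | tri≈ _ n≡m _ = contradiction n≡m n≢m
    ...     | tri> _ _ m<n = contradiction (at⇒∈ z-at′) (inner-fresh x (E m) (E n) (b↑ m<n) z-at a≤r)

    module _ (indep : ∀ {i j} → i < j → ¬ Adj (y i) (y j))
             (good : ∀ {i j} → i < j → ¬ AdjToPredecessor i j) where

      no-cross-edge : ∀ {n m a e p q} → n < m → At G (B n) a p → a ≤ r n → At G (B m) e q → e ≤ r m
                    → ¬ Adj p q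
      no-cross-edge {n} {m} {a} {p = p} n<m p-at a≤r q-at e≤r p~q
        with inner-edge x (E n) (E m) (b↑ n<m) p-at a≤r q-at e≤r p~q
      ... | refl , inj₁ refl =
        indep n<m (subst (λ z → Adj z (y m)) (at-functional p-at (penultimate-at (E n))) p~q)
      ... | refl , inj₂ 1+a≡r = good n<m (a , p , 1+a≡r , p-at , Adj-sym p~q)

      route-induced : ∀ n m p q → p ∈ route n → q ∈ route m → Adj p q
                    → (∃[ k ] Consec G (route k) p q) ⊎ Consec G (v ∷ x ∷ []) p q
      route-induced n m p q (here refl) (here refl) p~q = contradiction p~q irrefl
      route-induced n m p q (here refl) (there q∈)  p~q = map₁-⊎ (m ,_) (v-edge m q∈ p~q)
      route-induced n m p q (there p∈)  (here refl) p~q =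
        map-⊎ (λ edge → n , consec-sym edge) consec-sym (v-edge n p∈ (Adj-sym p~q))
      route-induced n m p q (there p∈)  (there q∈)  p~q
        with ∈-route-tail n p∈ | ∈-route-tail m q∈
      ... | a , p-at , c≤a | e , q-at , c≤e with x-or-inner n p-at | x-or-inner m q-at
      ...   | inj₁ refl | _         = inj₁ (m , route-edge m (x-at (E m)) q-at (m≤n⇒m≤1+n (c≤r m)) c≤e p~q)
      ...   | inj₂ _    | inj₁ refl = inj₁ (n , route-edge n p-at (x-at (E n)) c≤a (m≤n⇒m≤1+n (c≤r n)) p~q)
      ...   | inj₂ a≤r  | inj₂ e≤r with <-cmp n m
      ...     | tri< n<m _ _    = contradiction p~q (no-cross-edge n<m p-at a≤r q-at e≤r)
      ...     | tri≈ _ refl _   = inj₁ (n , route-edge n p-at q-at c≤a c≤e p~q)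
      ...     | tri> _ _ m<n    = contradiction (Adj-sym p~q) (no-cross-edge m<n q-at e≤r p-at a≤r)

      theta-via-routes : HasInducedThetaInf G
      theta-via-routes =
        theta-from-paths em route v≢x route-path route-distinct route-disjoint route-long route-induced
        where
        v≢x : v ≢ x
        v≢x v≡x = P⊆H (suc (b 0)) (at⇒∈ (x-at (E 0))) (sym v≡x)

lemma2p3 : ExcludedMiddle 0ℓ
    → (G : Graph) → InfiniteGraph G → TwoConnected G
    → (v : Graph.V G) → InfiniteDegree G v → ¬ HasInducedKInf G
    → (𝒱 : Graph.V G → Set)
    → (∀ x → 𝒱 x → Graph.Adj G v x) → Independent G 𝒱 → InfiniteSet G 𝒱
    → (vs ts : ℕ → Graph.V G) (P : ℕ → List (Graph.V G))
    → ConnTree.IsConnectingTree G (λ x → x ≢ v) 𝒱 vs ts P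
    → (x : Graph.V G) → ConnTree.TInfiniteDegree G (λ x → x ≢ v) 𝒱 vs ts P x
    → HasInducedThetaInf G
lemma2p3 em G _ _ v _ no-K∞ 𝒱 v~𝒱 _ _ vs ts P tree x (f , f-inj , x~f) =
  let b , b↑ , branch = unbounded⇒subsequence (branches-unbounded f-inj x~f) in from-branches b↑ branch
  where
  open Graph G using (Adj)
  open BranchSequence em G v 𝒱 vs ts P tree v~𝒱 x
  open InducedSubgraphs G using (clique⇒K∞)
  open Classical em using (ramsey)

  from-independent : ∀ {b} (b↑ : StrictlyIncreasing b) (branch : ∀ m → Branch x (b m))
                   → (∀ {i j} → i < j → ¬ Adj (y b b↑ branch i) (y b b↑ branch j))
                   → HasInducedThetaInf G
  from-independent {b} b↑ branch indep with ramsey (AdjToPredecessor b b↑ branch)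
  ... | h , h↑ , inj₁ bad  =
    theta-via-common-neighbours (b ∘ h) (strictlyIncreasing-∘ b↑ h↑) (branch ∘ h) (indep ∘ h↑) bad
  ... | h , h↑ , inj₂ good =
    theta-via-routes (b ∘ h) (strictlyIncreasing-∘ b↑ h↑) (branch ∘ h) (indep ∘ h↑) good

  from-branches : ∀ {b} (b↑ : StrictlyIncreasing b) (branch : ∀ m → Branch x (b m)) → HasInducedThetaInf G
  from-branches {b} b↑ branch with ramsey (λ i j → Adj (y b b↑ branch i) (y b b↑ branch j))
  ... | h , h↑ , inj₁ clique = contradiction
        (clique⇒K∞ (y b b↑ branch ∘ h) (strictlyIncreasing⇒injective h↑ ∘ y-injective b b↑ branch) clique)
        no-K∞
  ... | h , h↑ , inj₂ indep  = from-independent (strictlyIncreasing-∘ b↑ h↑) (branch ∘ h) indep
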